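{- Let $L\in\{\mathsf{CFL_e},\mathsf{MALL},\mathsf{CLL}\}$ with calculus $G$ (namely $\mathbf{CFL_e}$, $\mathbf{MALL}$, $\mathbf{CLL}$, over $\mathcal{L}_u$, $\mathcal{L}_b$, $\mathcal{L}_!$ respectively), fix formulas $D,N$ of the language $\mathcal{L}$ of $G$, and let $A$ be any $\mathcal{L}$-formula. Then each of the sequents $$A^t,A^s\Rightarrow D,\qquad (\neg A)^t\Rightarrow A^s,\quad A^s\Rightarrow(\neg A)^t,\qquad (\neg A)^s\Rightarrow A^t,\quad A^t\Rightarrow(\neg A)^s$$ has an $iG_D$-proof with $O(|A|)$ many lines.
   Context: Formulas. $\mathcal{L}_u$-formulas are built from atoms and constants $0,1$ by $\wedge,\vee,*,\to$; $\mathcal{L}_b$ adds constants $\top,\bot$; $\mathcal{L}_!$ adds unary $!$. $\neg A:=A\to0$. A sequent is $\Gamma\Rightarrow\Delta$ with finite multisets; single-conclusion if $|\Delta|\le1$. Calculi. $\mathbf{CFL_e}$ has axioms $A\Rightarrow A$, $\Rightarrow1$, $0\Rightarrow$ and rules: from $\Gamma\Rightarrow\Delta$ infer $\Gamma,1\Rightarrow\Delta$ and $\Gamma\Rightarrow0,\Delta$; from $\Gamma,A_i\Rightarrow\Delta$ infer $\Gamma,A_0\wedge A_1\Rightarrow\Delta$; from $\Gamma\Rightarrow A,\Delta$ and $\Gamma\Rightarrow B,\Delta$ infer $\Gamma\Rightarrow A\wedge B,\Delta$; from $\Gamma,A\Rightarrow\Delta$ and $\Gamma,B\Rightarrow\Delta$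 infer $\Gamma,A\vee B\Rightarrow\Delta$; from $\Gamma\Rightarrow A_i,\Delta$ infer $\Gamma\Rightarrow A_0\vee A_1,\Delta$; from $\Gamma,A,B\Rightarrow\Delta$ infer $\Gamma,A*B\Rightarrow\Delta$; from $\Gamma\Rightarrow A,\Delta$ and $\Sigma\Rightarrow B,\Lambda$ infer $\Gamma,\Sigma\Rightarrow A*B,\Delta,\Lambda$; from $\Gamma\Rightarrow A,\Delta$ and $\Sigma,B\Rightarrow\Lambda$ infer $\Gamma,\Sigma,A\to B\Rightarrow\Delta,\Lambda$; from $\Gamma,A\Rightarrow B,\Delta$ infer $\Gamma\Rightarrow A\to B,\Delta$; cut: from $\Gamma\Rightarrow A,\Delta$ and $\Sigma,A\Rightarrow\Lambda$ infer $\Gamma,\Sigma\Rightarrow\Delta,\Lambda$. $\mathbf{MALL}$ = $\mathbf{CFL_e}$ + axioms $\Gamma\Rightarrow\top,\Delta$, $\Gamma,\bot\Rightarrow\Delta$; $\mathbf{CLL}$ = $\mathbf{MALL}$ + exponential rules: from $!\Gamma\Rightarrow A$ infer $!\Gamma\Rightarrow!A$; from $\Gamma,A\Rightarrow\Delta$ infer $\Gamma,!A\Rightarrow\Delta$; from $\Gamma\Rightarrow\Delta$ infer $\Gamma,!A\Rightarrow\Delta$; from $\Gamma,!A,!A\Rightarrow\Delta$ infer $\Gamma,!A\Rightarrow\Delta$. $iG$ is the single-conclusion version of $G$ (all rules restricted to single-conclusion sequents), i.e. $\mathbf{FL_e}$, $\mathbf{IMALL}$, $\mathbf{ILL}$.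 $iG_D$ is $iG$ plus the extra initial sequents $p,N\Rightarrow D$ for every atom $p$. The number of lines of a proof is the total number of formula occurrences in its sequents. Chu's translation (parametrized by $D,N$), defined simultaneously: $p^t=p$; $1^t=1$, $0^t=D$, $\top^t=\top$, $\bot^t=\bot$; $(A\circ B)^t=A^t\circ B^t$ for $\circ\in\{\wedge,\vee,*\}$; $(A\to B)^t=(A^t\to B^t)\wedge(B^s\to A^s)$; $(!A)^t=!A^t$. $p^s=N$; $1^s=D$, $0^s=1$, $\top^s=\bot$, $\bot^s=\top$; $(A\wedge B)^s=A^s\vee B^s$; $(A\vee B)^s=A^s\wedge B^s$; $(A*B)^s=(A^t\to B^s)\wedge(B^t\to A^s)$; $(A\to B)^s=A^t*B^s$; $(!A)^s=!A^t\to D$. -}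

module Defs where

open import Data.Nat using (ℕ; zero; suc; _+_; _*_; _≤_)
open import Data.List using (List; []; _∷_; _++_; map; length)
open import Data.Maybe using (Maybe; just; nothing)
open import Data.Unit using (⊤)
open import Data.Empty using (⊥)
open import Data.Product using (Σ; _×_; ∃-syntax)
open import Data.List.Relation.Binary.Permutation.Propositional using (_↭_)

-- The three logics and their languages
--   CFLe : L_u,  MALL : L_b (adds ⊤,⊥),  CLL : L_! (L_b plus !)

data Logic : Set where
  CFLe MALL CLL : Logic

HasBounds : Logic → Set
HasBounds CFLe = ⊥
HasBounds MALL = ⊤
HasBounds CLL  = ⊤

HasBang : Logic → Set
HasBang CFLe = ⊥
HasBang MALL = ⊥
HasBang CLL  = ⊤

data Fm (L : Logic) : Set where
  atom  : ℕ → Fm L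
  𝟙 𝟘   : Fm L
  ⊤ᶠ ⊥ᶠ : HasBounds L → Fm L
  _∧ᶠ_ _∨ᶠ_ _*ᶠ_ _⇒ᶠ_ : Fm L → Fm L → Fm L
  !ᶠ    : HasBang L → Fm L → Fm L

infixr 6 _∧ᶠ_ _∨ᶠ_ _*ᶠ_
infixr 5 _⇒ᶠ_

¬ᶠ : ∀ {L} → Fm L → Fm L
¬ᶠ A = A ⇒ᶠ 𝟘

size : ∀ {L} → Fm L → ℕ
size (atom _)  = 1
size 𝟙         = 1
size 𝟘         = 1
size (⊤ᶠ _)    = 1
size (⊥ᶠ _)    = 1
size (A ∧ᶠ B)  = suc (size A + size B)
size (A ∨ᶠ B)  = suc (size A + size B)
size (A *ᶠ B)  = suc (size A + size B)
size (A ⇒ᶠ B)  = suc (size A + size B)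
size (!ᶠ _ A)  = suc (size A)

module Chu {L : Logic} (D N : Fm L) where
  mutual
    _ᵗ : Fm L → Fm L
    atom p ᵗ   = atom p
    𝟙 ᵗ        = 𝟙
    𝟘 ᵗ        = D
    ⊤ᶠ h ᵗ     = ⊤ᶠ h
    ⊥ᶠ h ᵗ     = ⊥ᶠ h
    (A ∧ᶠ B) ᵗ = (A ᵗ) ∧ᶠ (B ᵗ)
    (A ∨ᶠ B) ᵗ = (A ᵗ) ∨ᶠ (B ᵗ)
    (A *ᶠ B) ᵗ = (A ᵗ) *ᶠ (B ᵗ)
    (A ⇒ᶠ B) ᵗ = ((A ᵗ) ⇒ᶠ (B ᵗ)) ∧ᶠ ((B ˢ) ⇒ᶠ (A ˢ))
    !ᶠ h A ᵗ   = !ᶠ h (A ᵗ)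

    _ˢ : Fm L → Fm L
    atom p ˢ   = N
    𝟙 ˢ        = D
    𝟘 ˢ        = 𝟙
    ⊤ᶠ h ˢ     = ⊥ᶠ h
    ⊥ᶠ h ˢ     = ⊤ᶠ h
    (A ∧ᶠ B) ˢ = (A ˢ) ∨ᶠ (B ˢ)
    (A ∨ᶠ B) ˢ = (A ˢ) ∧ᶠ (B ˢ)
    (A *ᶠ B) ˢ = ((A ᵗ) ⇒ᶠ (B ˢ)) ∧ᶠ ((B ᵗ) ⇒ᶠ (A ˢ))
    (A ⇒ᶠ B) ˢ = (A ᵗ) *ᶠ (B ˢ)
    !ᶠ h A ˢ   = (!ᶠ h (A ᵗ)) ⇒ᶠ D

  infix 20 _ᵗ _ˢ

-- The single-conclusion calculus iG_D (G = CFLe / MALL / CLL according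
-- to L), with extra initial sequents  p , N ⇒ D  for every atom p.
-- Sequents Γ ⇒ δ: Γ a list read as a multiset (every rule's conclusion
-- may be any permutation of the displayed antecedent), δ : Maybe (Fm L)
-- (at most one conclusion formula).

Succ : Logic → Set
Succ L = Maybe (Fm L)

data IGD {L : Logic} (D N : Fm L) : List (Fm L) → Succ L → Set where
  ax    : ∀ {Γ} A → Γ ↭ (A ∷ []) → IGD D N Γ (just A)
  1R    : IGD D N [] (just 𝟙)
  0L    : ∀ {Γ} → Γ ↭ (𝟘 ∷ []) → IGD D N Γ nothing
  ⊤R    : ∀ {Γ} (h : HasBounds L) → IGD D N Γ (just (⊤ᶠ h))
  ⊥L    : ∀ {Γ Γ' δ} (h : HasBounds L) → Γ' ↭ (⊥ᶠ h ∷ Γ) → IGD D N Γ' δ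
  extra : ∀ {Γ} p → Γ ↭ (atom p ∷ N ∷ []) → IGD D N Γ (just D)
  1L    : ∀ {Γ Γ' δ} → IGD D N Γ δ → Γ' ↭ (𝟙 ∷ Γ) → IGD D N Γ' δ
  0R    : ∀ {Γ} → IGD D N Γ nothing → IGD D N Γ (just 𝟘)
  ∧L₀   : ∀ {Γ Γ' δ A B} → IGD D N (A ∷ Γ) δ → Γ' ↭ ((A ∧ᶠ B) ∷ Γ) → IGD D N Γ' δ
  ∧L₁   : ∀ {Γ Γ' δ A B} → IGD D N (B ∷ Γ) δ → Γ' ↭ ((A ∧ᶠ B) ∷ Γ) → IGD D N Γ' δ
  ∧R    : ∀ {Γ A B} → IGD D N Γ (just A) → IGD D N Γ (just B) → IGD D N Γ (just (A ∧ᶠ B))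
  ∨L    : ∀ {Γ Γ' δ A B} → IGD D N (A ∷ Γ) δ → IGD D N (B ∷ Γ) δ → Γ' ↭ ((A ∨ᶠ B) ∷ Γ) → IGD D N Γ' δ
  ∨R₀   : ∀ {Γ A B} → IGD D N Γ (just A) → IGD D N Γ (just (A ∨ᶠ B))
  ∨R₁   : ∀ {Γ A B} → IGD D N Γ (just B) → IGD D N Γ (just (A ∨ᶠ B))
  *L    : ∀ {Γ Γ' δ A B} → IGD D N (A ∷ B ∷ Γ) δ → Γ' ↭ ((A *ᶠ B) ∷ Γ) → IGD D N Γ' δ
  *R    : ∀ {Γ Σ Θ A B} → IGD D N Γ (just A) → IGD D N Σ (just B) → Θ ↭ (Γ ++ Σ) → IGD D N Θ (just (A *ᶠ B))
  ⇒L    : ∀ {Γ Σ Θ λ' A B} → IGD D N Γ (just A) → IGD D N (B ∷ Σ) λ' → Θ ↭ ((A ⇒ᶠ B) ∷ Γ ++ Σ) → IGD D N Θ λ'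
  ⇒R    : ∀ {Γ A B} → IGD D N (A ∷ Γ) (just B) → IGD D N Γ (just (A ⇒ᶠ B))
  cut   : ∀ {Γ Σ Θ λ' A} → IGD D N Γ (just A) → IGD D N (A ∷ Σ) λ' → Θ ↭ (Γ ++ Σ) → IGD D N Θ λ'
  !R    : ∀ {Θ A} (h : HasBang L) (Γ : List (Fm L)) → IGD D N (map (!ᶠ h) Γ) (just A) → Θ ↭ map (!ᶠ h) Γ → IGD D N Θ (just (!ᶠ h A))
  !D    : ∀ {Γ Γ' δ A} (h : HasBang L) → IGD D N (A ∷ Γ) δ → Γ' ↭ (!ᶠ h A ∷ Γ) → IGD D N Γ' δ
  !W    : ∀ {Γ Γ' δ A} (h : HasBang L) → IGD D N Γ δ → Γ' ↭ (!ᶠ h A ∷ Γ) → IGD D N Γ' δ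
  !C    : ∀ {Γ Γ' δ A} (h : HasBang L) → IGD D N (!ᶠ h A ∷ !ᶠ h A ∷ Γ) δ → Γ' ↭ (!ᶠ h A ∷ Γ) → IGD D N Γ' δ

occ : ∀ {L} → List (Fm L) → Succ L → ℕ
occ Γ (just _) = suc (length Γ)
occ Γ nothing  = length Γ

lines : ∀ {L} {D N : Fm L} {Γ δ} → IGD D N Γ δ → ℕ
lines {Γ = Γ} {δ} (ax _ _)       = occ Γ δ
lines {Γ = Γ} {δ} 1R             = occ Γ δ
lines {Γ = Γ} {δ} (0L _)         = occ Γ δ
lines {Γ = Γ} {δ} (⊤R _)         = occ Γ δ
lines {Γ = Γ} {δ} (⊥L _ _)       = occ Γ δ
lines {Γ = Γ} {δ} (extra _ _)    = occ Γ δ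
lines {Γ = Γ} {δ} (1L d _)       = occ Γ δ + lines d
lines {Γ = Γ} {δ} (0R d)         = occ Γ δ + lines d
lines {Γ = Γ} {δ} (∧L₀ d _)      = occ Γ δ + lines d
lines {Γ = Γ} {δ} (∧L₁ d _)      = occ Γ δ + lines d
lines {Γ = Γ} {δ} (∧R d e)       = occ Γ δ + lines d + lines e
lines {Γ = Γ} {δ} (∨L d e _)     = occ Γ δ + lines d + lines e
lines {Γ = Γ} {δ} (∨R₀ d)        = occ Γ δ + lines d
lines {Γ = Γ} {δ} (∨R₁ d)        = occ Γ δ + lines d
lines {Γ = Γ} {δ} (*L d _)       = occ Γ δ + lines d
lines {Γ = Γ} {δ} (*R d e _)     = occ Γ δ + lines d + lines e
lines {Γ = Γ} {δ} (⇒L d e _)     = occ Γ δ + lines d + lines e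
lines {Γ = Γ} {δ} (⇒R d)         = occ Γ δ + lines d
lines {Γ = Γ} {δ} (cut d e _)    = occ Γ δ + lines d + lines e
lines {Γ = Γ} {δ} (!R _ _ d _)   = occ Γ δ + lines d
lines {Γ = Γ} {δ} (!D _ d _)     = occ Γ δ + lines d
lines {Γ = Γ} {δ} (!W _ d _)     = occ Γ δ + lines d
lines {Γ = Γ} {δ} (!C _ d _)     = occ Γ δ + lines d

ProvableIn : ∀ {L} (D N : Fm L) → List (Fm L) → Succ L → ℕ → Set
ProvableIn D N Γ δ k = Σ (IGD D N Γ δ) (λ d → lines d ≤ k)

{-# OPTIONS --safe #-}
-- A ᵗ , A ˢ ⇒ D is proved by induction on A: the s-translation of each connective
-- is designed so that a few left rules (and an axiom) reduce the sequent to
-- the same sequent for immediate subformulas, atoms being covered by the extra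
-- initial sequents p , N ⇒ D. Every connective costs at most 13 lines, so the proof
-- has at most 13·|A| lines. Since (¬ A)ᵗ = (A ᵗ ⇒ D) ∧ (𝟙 ⇒ A ˢ) and (¬ A)ˢ = A ᵗ * 𝟙,
-- the four sequents for ¬ A take a bounded number of further lines.

module Submission where

open import Defs
open import Data.Nat using (_*_; _+_; suc; _≤_; _<_; _≤?_; z≤n; z<s; >-nonZero)
open import Data.Nat.Properties using (+-comm; +-assoc; ≤-refl; ≤-trans; +-mono-≤; *-monoˡ-≤; m≤m*n; *-suc; *-distribˡ-+; *-distribʳ-+; +-commutativeSemigroup; module ≤-Reasoning)
open import Data.List using ([]; _∷_)
open import Data.Maybe using (just)
open import Data.Product using (_×_; ∃-syntax; _,_)
open import Data.List.Relation.Binary.Permutation.Propositional using (_↭_; refl; prep; swap; trans)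
open import Data.List.Relation.Binary.Permutation.Propositional.Properties using (↭-length)
open import Relation.Binary.PropositionalEquality using (cong)
open import Relation.Nullary.Decidable using (from-yes)
open import Algebra.Properties.CommutativeSemigroup +-commutativeSemigroup using (x∙yz≈y∙xz)

0<size : ∀ {L} (A : Fm L) → 0 < size A
0<size (atom _) = z<s
0<size 𝟙        = z<s
0<size 𝟘        = z<s
0<size (⊤ᶠ _)   = z<s
0<size (⊥ᶠ _)   = z<s
0<size (_ ∧ᶠ _) = z<s
0<size (_ ∨ᶠ _) = z<s
0<size (_ *ᶠ _) = z<s
0<size (_ ⇒ᶠ _) = z<s
0<size (!ᶠ _ _) = z<s

const≤linear : ∀ {k} c s → 0 < s → k ≤ c → k ≤ c * s
const≤linear c s 0<s k≤c = ≤-trans k≤c (m≤m*n c s {{>-nonZero 0<s}})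

affine≤linear : ∀ {k x} c s → 0 < s → x ≤ c * s → k + x ≤ (k + c) * s
affine≤linear {k} {x} c s 0<s x≤cs = begin
  k + x         ≤⟨ +-mono-≤ (m≤m*n k s {{>-nonZero 0<s}}) x≤cs ⟩
  k * s + c * s ≡⟨ *-distribʳ-+ s k c ⟨
  (k + c) * s   ∎
  where open ≤-Reasoning

-- k + (x + (l + y)) is the normal form of the line count of a derivation made of
-- two subproofs of x and y lines and k + l further formula occurrences.
linear-step : ∀ {x y} c k l a b → k + l ≤ c → x ≤ c * a → y ≤ c * b →
              k + (x + (l + y)) ≤ c * suc (a + b)
linear-step {x} {y} c k l a b k+l≤c x≤ca y≤cb = begin
  k + (x + (l + y))   ≡⟨ cong (k +_) (x∙yz≈y∙xz x l y) ⟩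
  k + (l + (x + y))   ≡⟨ +-assoc k l (x + y) ⟨
  k + l + (x + y)     ≤⟨ +-mono-≤ k+l≤c (+-mono-≤ x≤ca y≤cb) ⟩
  c + (c * a + c * b) ≡⟨ cong (c +_) (*-distribˡ-+ c a b) ⟨
  c + c * (a + b)     ≡⟨ *-suc c (a + b) ⟨
  c * suc (a + b)     ∎
  where open ≤-Reasoning

module _ {L : Logic} (D N : Fm L) where
  open Chu D N

  exchange : ∀ {X Y : Fm L} → X ∷ Y ∷ [] ↭ Y ∷ X ∷ []
  exchange = swap _ _ refl

  rotate : ∀ {X Y Z : Fm L} → X ∷ Y ∷ Z ∷ [] ↭ Z ∷ X ∷ Y ∷ []
  rotate = trans (prep _ exchange) (swap _ _ refl)

  -- The antecedent is taken up to permutation so that the ∨ and * cases can use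
  -- the pairing of a subformula in either order without an exchange cut.
  chu-pairing : ∀ {Γ} A → Γ ↭ A ᵗ ∷ A ˢ ∷ [] → IGD D N Γ (just D)
  chu-pairing (atom p) π = extra p π
  chu-pairing 𝟙        π = 1L (ax D refl) π
  chu-pairing 𝟘        π = 1L (ax D refl) (trans π exchange)
  chu-pairing (⊤ᶠ h)   π = ⊥L h (trans π exchange)
  chu-pairing (⊥ᶠ h)   π = ⊥L h π
  chu-pairing (A ∧ᶠ B) π =
    ∨L (∧L₀ (chu-pairing A refl) exchange) (∧L₁ (chu-pairing B refl) exchange) (trans π exchange)
  chu-pairing (A ∨ᶠ B) π =
    ∨L (∧L₀ (chu-pairing A exchange) exchange) (∧L₁ (chu-pairing B exchange) exchange) π
  chu-pairing (A *ᶠ B) π = *L (∧L₀ (⇒L (ax (A ᵗ) refl) (chu-pairing B exchange) refl) rotate) π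
  chu-pairing (A ⇒ᶠ B) π = *L (∧L₀ (⇒L (ax (A ᵗ) refl) (chu-pairing B refl) refl) rotate) (trans π exchange)
  chu-pairing (!ᶠ h A) π = ⇒L (ax (!ᶠ h (A ᵗ)) refl) (ax D refl) (trans π exchange)

  lines-chu-pairing : ∀ {Γ} A (π : Γ ↭ A ᵗ ∷ A ˢ ∷ []) → lines (chu-pairing A π) ≤ 13 * size A
  lines-chu-pairing (atom p) π rewrite ↭-length π = from-yes (3 ≤? 13)
  lines-chu-pairing 𝟙        π rewrite ↭-length π = from-yes (5 ≤? 13)
  lines-chu-pairing 𝟘        π rewrite ↭-length π = from-yes (5 ≤? 13)
  lines-chu-pairing (⊤ᶠ h)   π rewrite ↭-length π = from-yes (3 ≤? 13)
  lines-chu-pairing (⊥ᶠ h)   π rewrite ↭-length π = from-yes (3 ≤? 13)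
  lines-chu-pairing (A ∧ᶠ B) π rewrite ↭-length π =
    linear-step 13 6 3 (size A) (size B) (from-yes (9 ≤? 13)) (lines-chu-pairing A refl) (lines-chu-pairing B refl)
  lines-chu-pairing (A ∨ᶠ B) π rewrite ↭-length π =
    linear-step 13 6 3 (size A) (size B) (from-yes (9 ≤? 13)) (lines-chu-pairing A exchange) (lines-chu-pairing B exchange)
  lines-chu-pairing (A *ᶠ B) π rewrite ↭-length π =
    linear-step 13 13 0 (size A) (size B) ≤-refl z≤n (lines-chu-pairing B exchange)
  lines-chu-pairing (A ⇒ᶠ B) π rewrite ↭-length π =
    linear-step 13 13 0 (size A) (size B) ≤-refl z≤n (lines-chu-pairing B refl)
  lines-chu-pairing (!ᶠ h A) π rewrite ↭-length π = const≤linear 13 (suc (size A)) z<s (from-yes (7 ≤? 13))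

  ¬ᵗ⊢ˢ : ∀ A → IGD D N ((¬ᶠ A) ᵗ ∷ []) (just (A ˢ))
  ¬ᵗ⊢ˢ A = ∧L₁ (⇒L 1R (ax _ refl) refl) refl

  ˢ⊢¬ᵗ : ∀ A → IGD D N (A ˢ ∷ []) (just ((¬ᶠ A) ᵗ))
  ˢ⊢¬ᵗ A = ∧R (⇒R (chu-pairing A refl)) (⇒R (1L (ax _ refl) refl))

  lines-ˢ⊢¬ᵗ : ∀ A → lines (ˢ⊢¬ᵗ A) ≤ 24 * size A
  lines-ˢ⊢¬ᵗ A = begin
    4 + (lines (chu-pairing A refl) + 7) ≡⟨ cong (4 +_) (+-comm (lines (chu-pairing A refl)) 7) ⟩
    11 + lines (chu-pairing A refl)      ≤⟨ affine≤linear 13 (size A) (0<size A) (lines-chu-pairing A refl) ⟩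
    24 * size A                          ∎
    where open ≤-Reasoning

  ¬ˢ⊢ᵗ : ∀ A → IGD D N ((¬ᶠ A) ˢ ∷ []) (just (A ᵗ))
  ¬ˢ⊢ᵗ A = *L (1L (ax _ refl) exchange) refl

  ᵗ⊢¬ˢ : ∀ A → IGD D N (A ᵗ ∷ []) (just ((¬ᶠ A) ˢ))
  ᵗ⊢¬ˢ A = *R (ax _ refl) 1R refl

lemma13 : (L : Logic) (D N : Fm L) → ∃[ c ] ((A : Fm L) →
            let open Chu D N in
              ProvableIn D N (A ᵗ ∷ A ˢ ∷ []) (just D) (c * size A)
            × ProvableIn D N ((¬ᶠ A) ᵗ ∷ []) (just (A ˢ)) (c * size A)
            × ProvableIn D N (A ˢ ∷ []) (just ((¬ᶠ A) ᵗ)) (c * size A)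
            × ProvableIn D N ((¬ᶠ A) ˢ ∷ []) (just (A ᵗ)) (c * size A)
            × ProvableIn D N (A ᵗ ∷ []) (just ((¬ᶠ A) ˢ)) (c * size A))
lemma13 L D N = 24 , λ A →
    (chu-pairing D N A refl , ≤-trans (lines-chu-pairing D N A refl) (*-monoˡ-≤ (size A) (from-yes (13 ≤? 24))))
  , (¬ᵗ⊢ˢ D N A , const≤linear 24 (size A) (0<size A) (from-yes (7 ≤? 24)))
  , (ˢ⊢¬ᵗ D N A , lines-ˢ⊢¬ᵗ D N A)
  , (¬ˢ⊢ᵗ D N A , const≤linear 24 (size A) (0<size A) (from-yes (7 ≤? 24)))
  , (ᵗ⊢¬ˢ D N A , const≤linear 24 (size A) (0<size A) (from-yes (5 ≤? 24)))
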